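{- Let $n$ be a positive integer with $r = \mathsf{sr}(n) \geq 2$, and suppose $\mathsf{Alist}_n$ contains consecutive pairs $\langle i,u\rangle \to \langle i+1,v\rangle$. Then $$u \in \begin{cases} \left\{ v-2+\left\lfloor \frac{v-1}{i}\right\rfloor,\ v-1+\left\lfloor \frac{v-1}{i}\right\rfloor\right\}, & \text{if } i \mid v-1,\\[4pt] \left\{ v-1+\left\lfloor \frac{v-1}{i}\right\rfloor\right\}, & \text{if } i \nmid v-1.\end{cases}$$
   Context: For $n \in \{1,2,\ldots\}$, $\mathsf{Alist}_n$ is the sequence of integer pairs produced as follows: begin with $\langle 1, n\rangle$. Given the current pair $\langle i, y_i\rangle$ with $y_i > i$, the next pair is $\langle i+1, y_{i+1}\rangle$, where $y_{i+1}$ is the smallest integer with $(i+1)y_{i+1} > i(y_i+1)$. Stop when the current pair $\langle i,y_i\rangle$ satisfies $y_i \leq i$. This process always terminates; its final pair is denoted $\langle \mathsf{sr}(n), y_{\mathsf{sr}(n)}\rangle$ (and $y_{\mathsf{sr}(n)}=\mathsf{sr}(n)$), and $\mathsf{sr}(n)$ is called the strange root of $n$. -}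

module Defs where

open import Data.Nat using (ℕ; suc; _+_; _*_; _<_; _≤_)
open import Data.Product using (Σ; _×_)

-- v is the successor value of the pair ⟨i, u⟩: the smallest integer v with
-- (i+1) v > i (u+1).  (Any such integer is positive since i(u+1) ≥ 0, so the
-- smallest one over ℤ is the smallest one over ℕ.)
IsNext : ℕ → ℕ → ℕ → Set
IsNext i u v = (i * (u + 1) < suc i * v) × (∀ w → i * (u + 1) < suc i * w → v ≤ w)

-- InAlist n i y : the pair ⟨i, y⟩ occurs in Alist_n.
-- Start with ⟨1, n⟩; from ⟨i, u⟩ with u > i (not yet stopped) go to ⟨i+1, v⟩.
data InAlist (n : ℕ) : ℕ → ℕ → Set where
  start : InAlist n 1 n
  step  : ∀ {i u v} → InAlist n i u → i < u → IsNext i u v → InAlist n (suc i) v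

IsStrangeRoot : ℕ → ℕ → Set
IsStrangeRoot n r = Σ ℕ (λ y → InAlist n r y × y ≤ r)

Consecutive : ℕ → ℕ → ℕ → ℕ → Set
Consecutive n i u v = InAlist n i u × i < u × IsNext i u v

{-# OPTIONS --safe #-}
-- Write v = m + 1 and m = q i + t with 0 ≤ t < i.  Then (i+1) m = i (m + q) + t, so the two
-- conditions defining v, namely (i+1) m ≤ i (u+1) < (i+1)(m+1), squeeze u + 1 between
-- m + q and m + q + 1, and u + 1 = m + q forces t = 0, i.e. i ∣ v − 1.
module Submission where

open import Defs
open import Data.Nat using (ℕ; suc; zero; _+_; _*_; _∸_; _≤_; _<_; NonZero)
open import Data.Nat.DivMod using (_/_; _%_; m≡m%n+[m/n]*n; m%n<n)
open import Data.Nat.Divisibility using (_∣_; m%n≡0⇒n∣m)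
open import Data.Nat.Properties
open import Data.Nat.Tactic.RingSolver using (solve)
open import Data.List using ([]; _∷_)
open import Data.Product using (_×_; _,_)
open import Data.Sum using (_⊎_; inj₁; inj₂)
open import Data.Empty using (⊥-elim)
open import Relation.Binary.PropositionalEquality using (_≡_; refl; sym; cong; subst)
open import Relation.Nullary using (¬_)

module _ (i q t : ℕ) .{{_ : NonZero i}} (t<i : t < i) where

  suc*≡*[+q]+t : suc i * (t + q * i) ≡ i * (t + q * i + q) + t
  suc*≡*[+q]+t = solve (i ∷ q ∷ t ∷ [])

  suc*suc≤*[2++q] : suc i * suc (t + q * i) ≤ i * suc (suc (t + q * i + q))
  suc*suc≤*[2++q] = begin
    suc i * suc (t + q * i)              ≡⟨ solve (i ∷ q ∷ t ∷ []) ⟩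
    i * suc (t + q * i + q) + suc t      ≤⟨ +-monoʳ-≤ (i * suc (t + q * i + q)) t<i ⟩
    i * suc (t + q * i + q) + i          ≡⟨ solve (i ∷ q ∷ t ∷ []) ⟩
    i * suc (suc (t + q * i + q))        ∎
    where open ≤-Reasoning

  module _ (U : ℕ) (lower : suc i * (t + q * i) ≤ i * U)
           (upper : i * U < suc i * suc (t + q * i)) where

    private
      lower′ : i * (t + q * i + q) + t ≤ i * U
      lower′ = subst (_≤ i * U) suc*≡*[+q]+t lower

    +q≤ : t + q * i + q ≤ U
    +q≤ = *-cancelˡ-≤ i (≤-trans (m≤m+n _ t) lower′)

    ≤suc[+q] : U ≤ suc (t + q * i + q)
    ≤suc[+q] = ≤-pred (*-cancelˡ-< i U _ (<-≤-trans upper suc*suc≤*[2++q]))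

    ≡+q⇒t≡0 : U ≡ t + q * i + q → t ≡ 0
    ≡+q⇒t≡0 refl = n≤0⇒n≡0 (+-cancelˡ-≤ (i * U) t 0
      (subst (i * U + t ≤_) (sym (+-identityʳ (i * U))) lower′))

    bracketed-multiple : U ≡ suc (t + q * i + q) ⊎ (U ≡ t + q * i + q × t ≡ 0)
    bracketed-multiple with m≤n⇒m<n∨m≡n +q≤
    ... | inj₁ +q<U = inj₁ (≤-antisym ≤suc[+q] +q<U)
    ... | inj₂ +q≡U = inj₂ (sym +q≡U , ≡+q⇒t≡0 (sym +q≡U))

¬IsNext-zero : ∀ i u → ¬ IsNext i u 0
¬IsNext-zero i u (above , _) = n≮0 (subst (i * (u + 1) <_) (*-zeroʳ (suc i)) above)

IsNext⇒previous : ∀ i u m .{{_ : NonZero i}} → IsNext i u (suc m) →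
  u + 1 ≡ suc (m + m / i) ⊎ (u + 1 ≡ m + m / i × m % i ≡ 0)
IsNext⇒previous i u m (above , minimal)
  with m % i | m / i | m≡m%n+[m/n]*n m i | m%n<n m i
... | t | q | refl | t<i =
  bracketed-multiple i q t t<i (u + 1) (≮⇒≥ λ m-above → n≮n _ (minimal _ m-above)) above

proposition4p1 : (n r i u v : ℕ) → 1 ≤ n → IsStrangeRoot n r → 2 ≤ r →
    Consecutive n i u v → {{_ : NonZero i}} →
    (i ∣ v ∸ 1 → (u + 2 ≡ v + (v ∸ 1) / i) ⊎ (u + 1 ≡ v + (v ∸ 1) / i)) ×
    (¬ (i ∣ v ∸ 1) → u + 1 ≡ v + (v ∸ 1) / i)
proposition4p1 n r i u zero _ _ _ (_ , _ , next) = ⊥-elim (¬IsNext-zero i u next)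
proposition4p1 n r i u (suc m) _ _ _ (_ , _ , next) with IsNext⇒previous i u m next
... | inj₁ u+1≡ = (λ _ → inj₂ u+1≡) , (λ _ → u+1≡)
... | inj₂ (u+1≡ , m%i≡0) =
  (λ _ → inj₁ (subst (_≡ suc m + m / i) (sym (+-suc u 1)) (cong suc u+1≡))) ,
  (λ i∤m → ⊥-elim (i∤m (m%n≡0⇒n∣m m i m%i≡0)))
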